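{- Let $n \ge 5$ and let $t$ be an integer with $2 < t \le n-2$. Let $\mathcal{A}_2$ be OPTIMISTIC with $k=2$ and sampling threshold $t$, and let $\mathcal{A}_1$ be SINGLE-REF with $k = r = 1$ and sampling threshold $t$. Then, for a uniformly random arrival order of $n$ items with distinct values $v_1 > v_2 > \dots > v_n$, \[ \Pr[\mathcal{A}_2 \text{ accepts } v_2] = \Pr[\mathcal{A}_1 \text{ accepts } v_1]. \]
   Context: Items arrive one by one in an order given by a uniformly random permutation; each accept/reject decision is immediate and irrevocable. SINGLE-REF with $k=r=1$ and threshold $t$: reject the first $t-1$ items, then accept the first item better than the best of those $t-1$ items (at most one item accepted). OPTIMISTIC with $k=2$ and threshold $t$: reject the first $t-1$ items; let $s_1 > s_2$ be the two best among them; accept as first item the first item (at position $\ge t$) better than $s_2$; after that, accept as second item the first subsequent item better than $s_1$; at most two items are accepted. -}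

module Defs where

open import Data.Nat using (ℕ; zero; suc; _∸_; _⊓_; _<?_; _≟_)
open import Data.List using (List; []; _∷_; take; drop; filter; length; foldr; concatMap; upTo)
open import Data.Maybe using (Maybe; just; nothing)
open import Data.Product using (_×_; _,_)
open import Relation.Nullary using (yes; no; ¬?; Dec)
open import Relation.Unary using (Decidable)
open import Data.List.Relation.Unary.Unique.DecPropositional _≟_ using (unique?)
open import Data.List.Relation.Unary.Any using (any?)
open import Relation.Binary.PropositionalEquality using (_≡_)

-- Items are identified by their RANK: rank i (0-based) is the item with value v_(i+1),
-- so rank 0 = v_1 (best), rank 1 = v_2, ...; "x better than y" iff rank x < rank y.
-- An arrival order of n items is a list σ of length n with distinct entries in {0,…,n-1};
-- σ[p] is the rank of the item arriving at (1-based) position p+1.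

words : ℕ → ℕ → List (List ℕ)
words n zero = [] ∷ []
words n (suc m) = concatMap (λ x → Data.List.map (x ∷_) (words n m)) (upTo n)

orders : ℕ → List (List ℕ)
orders n = filter unique? (words n n)

-- number of arrival orders satisfying a decidable event; under the uniform
-- distribution Pr[E] = count E (orders n) / n!
count : {P : List ℕ → Set} → Decidable P → List (List ℕ) → ℕ
count P? xs = length (filter P? xs)

firstBelow : ℕ → List ℕ → Maybe (ℕ × List ℕ)
firstBelow b [] = nothing
firstBelow b (x ∷ xs) with x <? b
... | yes _ = just (x , xs)
... | no _ = firstBelow b xs

-- best (minimum rank) of a nonempty sample of items from n items (default n is never attained)
best : ℕ → List ℕ → ℕ
best n xs = foldr _⊓_ n xs

secondBest : ℕ → List ℕ → ℕ
secondBest n xs = best n (filter (λ x → ¬? (x ≟ best n xs)) xs)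

singleRef : ℕ → ℕ → List ℕ → Maybe ℕ
singleRef n t σ with firstBelow (best n (take (t ∸ 1) σ)) (drop (t ∸ 1) σ)
... | nothing = nothing
... | just (a , _) = just a

optimistic : ℕ → ℕ → List ℕ → List ℕ
optimistic n t σ with firstBelow (secondBest n (take (t ∸ 1) σ)) (drop (t ∸ 1) σ)
... | nothing = []
... | just (a , rest) with firstBelow (best n (take (t ∸ 1) σ)) rest
...    | nothing = a ∷ []
...    | just (b , _) = a ∷ b ∷ []

accepts : ℕ → List ℕ → Set
accepts v acc = Data.List.Relation.Unary.Any.Any (v ≡_) acc

accepts? : (v : ℕ) → Decidable (accepts v)
accepts? v acc = any? (v ≟_) acc

Opt-accepts-v2 : ℕ → ℕ → List ℕ → Set
Opt-accepts-v2 n t σ = accepts 1 (optimistic n t σ)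

Opt-accepts-v2? : (n t : ℕ) → Decidable (Opt-accepts-v2 n t)
Opt-accepts-v2? n t σ = accepts? 1 (optimistic n t σ)

Single-accepts-v1 : ℕ → ℕ → List ℕ → Set
Single-accepts-v1 n t σ = singleRef n t σ ≡ just 0

Single-accepts-v1? : (n t : ℕ) → Decidable (Single-accepts-v1 n t)
Single-accepts-v1? n t σ with singleRef n t σ
... | nothing = no (λ ())
... | just a with a ≟ 0
...   | yes Relation.Binary.PropositionalEquality.refl = yes Relation.Binary.PropositionalEquality.refl
...   | no a≢0 = no λ { Relation.Binary.PropositionalEquality.refl → a≢0 Relation.Binary.PropositionalEquality.refl }

-- Ranks are compared numerically, rank 0 being v₁; let s₁ < s₂ be the two best ranks in the sample.
-- We relabel every order in which SINGLE-REF accepts rank 0 into one in which OPTIMISTIC accepts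
-- rank 1, and back, by permutations of the ranks that fix every rank ≥ s₂, so that the second best
-- of the sample, and with it the first threshold of OPTIMISTIC, is unchanged. Usually the relabelling
-- swaps ranks 0 and 1. This fails in one situation on each side, where a 3-cycle is used instead:
-- if SINGLE-REF accepts 0, the sample best is 1 and the first item d < s₂ after the sample is not 0,
-- apply 1 ↦ d ↦ e ↦ 1, where e is the next item below d, so that OPTIMISTIC accepts e and then 1;
-- if OPTIMISTIC first accepts some a < s₁ with a ≠ 1, apply the inverse cycle 1 ↦ a ↦ s₁ ↦ 1.
-- The two relabellings undo each other, so both events are counted by the same number of orders.

module Submission where

open import Defs
open import Data.Nat using (ℕ; zero; suc; _+_; _≤_; _<_; _∸_; _⊓_; _≟_; _<?_; z≤n; s≤s)
open import Data.Nat.Properties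
open import Data.List using (List; []; _∷_; _++_; map; take; drop; filter; length; upTo)
open import Data.List.Properties
  using (length-map; length-++; length-upTo; length-take; ∷-injectiveˡ; ∷-injectiveʳ; map-++; ++-assoc;
         map-∘; map-cong; map-id; take-map; drop-map; take++drop≡id)
open import Data.List.Membership.Propositional using (_∈_; _∉_; find; lose)
open import Data.List.Membership.Propositional.Properties
open import Data.List.Membership.DecPropositional _≟_ using (_∈?_)
open import Data.List.Relation.Binary.Subset.Propositional using (_⊆_)
open import Data.List.Relation.Binary.Disjoint.Propositional using (Disjoint)
open import Data.List.Relation.Unary.Any using (here; there)
open import Data.List.Relation.Unary.All as All using (All; []; _∷_)
import Data.List.Relation.Unary.All.Properties as All
open import Data.List.Relation.Unary.AllPairs as AllPairs using ([]; _∷_)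
import Data.List.Relation.Unary.AllPairs.Properties as AllPairs
open import Data.List.Relation.Unary.Unique.Propositional using (Unique)
import Data.List.Relation.Unary.Unique.Propositional.Properties as Unique
open import Data.List.Relation.Unary.Unique.DecPropositional _≟_ using (unique?)
open import Data.Maybe using (just; nothing)
open import Data.Product using (_×_; _,_; ∃; ∃₂; proj₁; proj₂)
open import Data.Sum using (_⊎_; inj₁; inj₂)
open import Data.Empty using (⊥-elim)
open import Function using (_∘_)
open import Relation.Nullary using (¬_; Dec; yes; no; ¬?)
open import Relation.Unary using (Decidable)
open import Relation.Binary.PropositionalEquality


private
  variable
    A : Set

-- Lists without repetition, and counting by a bijection

Unique-++⇒Disjoint : ∀ (xs : List A) {ys} → Unique (xs ++ ys) → Disjoint xs ys
Unique-++⇒Disjoint (x ∷ xs) (x∉ ∷ _) (here refl , v∈ys) = All.lookup (All.++⁻ʳ xs x∉) v∈ys refl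
Unique-++⇒Disjoint (x ∷ xs) (_ ∷ u) (there v∈xs , v∈ys) = Unique-++⇒Disjoint xs u (v∈xs , v∈ys)

Unique-++-∷⇒∉ : ∀ (xs : List A) {x ys} → Unique (xs ++ x ∷ ys) → x ∉ ys
Unique-++-∷⇒∉ [] (x∉ ∷ _) x∈ = All.lookup x∉ x∈ refl
Unique-++-∷⇒∉ (_ ∷ xs) (_ ∷ u) = Unique-++-∷⇒∉ xs u

∈-++-∷⇒∈-++ : ∀ {x v : A} ys {zs} → v ∈ ys ++ x ∷ zs → v ≢ x → v ∈ ys ++ zs
∈-++-∷⇒∈-++ []       (here refl) v≢x = ⊥-elim (v≢x refl)
∈-++-∷⇒∈-++ []       (there p)   v≢x = p
∈-++-∷⇒∈-++ (y ∷ ys) (here refl) v≢x = here refl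
∈-++-∷⇒∈-++ (y ∷ ys) (there p)   v≢x = there (∈-++-∷⇒∈-++ ys p v≢x)

Unique-⊆⇒length≤ : ∀ {xs ys : List A} → Unique xs → xs ⊆ ys → length xs ≤ length ys
Unique-⊆⇒length≤ {xs = []} _ _ = z≤n
Unique-⊆⇒length≤ {xs = x ∷ xs} (x∉ ∷ u) xs⊆ys with ∈-∃++ (xs⊆ys (here refl))
... | ys₁ , ys₂ , refl = begin
  suc (length xs)            ≤⟨ s≤s (Unique-⊆⇒length≤ u xs⊆ys₁ys₂) ⟩
  suc (length (ys₁ ++ ys₂))  ≡⟨ cong suc (length-++ ys₁) ⟩
  suc (length ys₁ + length ys₂) ≡⟨ +-suc (length ys₁) (length ys₂) ⟨
  length ys₁ + suc (length ys₂) ≡⟨ length-++ ys₁ ⟨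
  length (ys₁ ++ x ∷ ys₂)    ∎
  where
    open ≤-Reasoning
    xs⊆ys₁ys₂ : xs ⊆ ys₁ ++ ys₂
    xs⊆ys₁ys₂ v∈ = ∈-++-∷⇒∈-++ ys₁ (xs⊆ys (there v∈)) λ { refl → All.lookup x∉ v∈ refl }

Unique-map-retraction : ∀ (f g : A → A) {xs} → Unique xs → (∀ {x} → x ∈ xs → g (f x) ≡ x) →
                        Unique (map f xs)
Unique-map-retraction f g {[]} [] _ = []
Unique-map-retraction f g {x ∷ xs} (x∉ ∷ u) gf =
  All.tabulate fx∉ ∷ Unique-map-retraction f g u (λ p → gf (there p))
  where
    fx∉ : ∀ {z} → z ∈ map f xs → f x ≢ z
    fx∉ z∈ fx≡z with ∈-map⁻ f z∈
    ... | y , y∈ , refl =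
      All.lookup x∉ y∈ (trans (sym (gf (here refl))) (trans (cong g fx≡z) (gf (there y∈))))

count-≤-injection : ∀ {P Q : List ℕ → Set} (P? : Decidable P) (Q? : Decidable Q) {L} → Unique L →
                    (f g : List ℕ → List ℕ) →
                    (∀ {σ} → σ ∈ L → P σ → f σ ∈ L × Q (f σ) × g (f σ) ≡ σ) →
                    count P? L ≤ count Q? L
count-≤-injection P? Q? {L} L! f g into = begin
  length (filter P? L)         ≡⟨ length-map f (filter P? L) ⟨
  length (map f (filter P? L)) ≤⟨ Unique-⊆⇒length≤ fP! fP⊆Q ⟩
  length (filter Q? L)         ∎
  where
    open ≤-Reasoning
    fP! : Unique (map f (filter P? L))
    fP! = Unique-map-retraction f g (Unique.filter⁺ P? L!) λ p →
            let σ∈ , Pσ = ∈-filter⁻ P? p in proj₂ (proj₂ (into σ∈ Pσ))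
    fP⊆Q : map f (filter P? L) ⊆ filter Q? L
    fP⊆Q p with ∈-map⁻ f p
    ... | σ , p′ , refl with ∈-filter⁻ P? p′
    ...   | σ∈ , Pσ = let fσ∈ , Qfσ , _ = into σ∈ Pσ in ∈-filter⁺ Q? fσ∈ Qfσ

count-≡-bijection : ∀ {P Q : List ℕ → Set} (P? : Decidable P) (Q? : Decidable Q) {L} → Unique L →
                    (f g : List ℕ → List ℕ) →
                    (∀ {σ} → σ ∈ L → P σ → f σ ∈ L × Q (f σ) × g (f σ) ≡ σ) →
                    (∀ {τ} → τ ∈ L → Q τ → g τ ∈ L × P (g τ) × f (g τ) ≡ τ) →
                    count P? L ≡ count Q? L
count-≡-bijection P? Q? L! f g into onto =
  ≤-antisym (count-≤-injection P? Q? L! f g into) (count-≤-injection Q? P? L! g f onto)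

-- Arrival orders

record IsOrder (n : ℕ) (σ : List ℕ) : Set where
  field
    length≡ : length σ ≡ n
    bounded : ∀ {v} → v ∈ σ → v < n
    unique  : Unique σ

∈-words-suc⁻ : ∀ n m {σ} → σ ∈ words n (suc m) → ∃₂ λ h τ → σ ≡ h ∷ τ × h < n × τ ∈ words n m
∈-words-suc⁻ n m σ∈ with find (∈-concatMap⁻ (λ x → map (x ∷_) (words n m)) {xs = upTo n} σ∈)
... | h , h∈ , σ∈′ with ∈-map⁻ (h ∷_) σ∈′
...   | τ , τ∈ , refl = h , τ , refl , ∈-upTo⁻ h∈ , τ∈

∈-words⁻ : ∀ n m {σ} → σ ∈ words n m → length σ ≡ m × (∀ {v} → v ∈ σ → v < n)
∈-words⁻ n zero (here refl) = refl , λ ()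
∈-words⁻ n (suc m) σ∈ with ∈-words-suc⁻ n m σ∈
... | h , τ , refl , h<n , τ∈ with ∈-words⁻ n m τ∈
...   | |τ|≡m , τ<n = cong suc |τ|≡m , λ { (here refl) → h<n ; (there v∈) → τ<n v∈ }

∈-words⁺ : ∀ n σ → (∀ {v} → v ∈ σ → v < n) → σ ∈ words n (length σ)
∈-words⁺ n [] _ = here refl
∈-words⁺ n (h ∷ τ) σ<n =
  ∈-concatMap⁺ (λ x → map (x ∷_) (words n (length τ))) {xs = upTo n}
    (lose (∈-upTo⁺ (σ<n (here refl))) (∈-map⁺ (h ∷_) (∈-words⁺ n τ (σ<n ∘ there))))

words-unique : ∀ n m → Unique (words n m)
words-unique n zero = [] ∷ []
words-unique n (suc m) =
  Unique.concat⁺ (All.map⁺ (All.tabulate λ _ → Unique.map⁺ ∷-injectiveʳ (words-unique n m)))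
                 (AllPairs.map⁺ (AllPairs.map disjoint (Unique.upTo⁺ n)))
  where
    disjoint : ∀ {h h′} → h ≢ h′ → Disjoint (map (h ∷_) (words n m)) (map (h′ ∷_) (words n m))
    disjoint h≢h′ (p , p′) with ∈-map⁻ _ p | ∈-map⁻ _ p′
    ... | _ , _ , refl | _ , _ , eq = h≢h′ (∷-injectiveˡ eq)

orders-unique : ∀ n → Unique (orders n)
orders-unique n = Unique.filter⁺ unique? (words-unique n n)

∈-orders⁻ : ∀ n {σ} → σ ∈ orders n → IsOrder n σ
∈-orders⁻ n σ∈ with ∈-filter⁻ unique? {xs = words n n} σ∈
... | σ∈words , σ! with ∈-words⁻ n n σ∈words
...   | |σ|≡n , σ<n = record { length≡ = |σ|≡n ; bounded = σ<n ; unique = σ! }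

∈-orders⁺ : ∀ n {σ} → IsOrder n σ → σ ∈ orders n
∈-orders⁺ n {σ} o = ∈-filter⁺ unique? {xs = words n n}
  (subst (λ m → σ ∈ words n m) length≡ (∈-words⁺ n σ bounded)) unique
  where open IsOrder o

IsOrder-complete : ∀ {n σ} → IsOrder n σ → ∀ {v} → v < n → v ∈ σ
IsOrder-complete {n} {σ} o {v} v<n with v ∈? σ
... | yes v∈ = v∈
... | no v∉ = ⊥-elim (<-irrefl refl (begin-strict
  n                  ≡⟨ length≡ ⟨
  length σ           <⟨ n<1+n (length σ) ⟩
  length (v ∷ σ)     ≤⟨ Unique-⊆⇒length≤ (All.tabulate (λ { u∈ refl → v∉ u∈ }) ∷ unique) v∷σ⊆ ⟩
  length (upTo n)    ≡⟨ length-upTo n ⟩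
  n                  ∎))
  where
    open IsOrder o
    open ≤-Reasoning
    v∷σ⊆ : v ∷ σ ⊆ upTo n
    v∷σ⊆ (here refl) = ∈-upTo⁺ v<n
    v∷σ⊆ (there u∈) = ∈-upTo⁺ (bounded u∈)

-- The first item below a threshold

firstBelow-just⁻ : ∀ {b a R R′} → firstBelow b R ≡ just (a , R′) →
                   ∃ λ pre → R ≡ pre ++ a ∷ R′ × All (b ≤_) pre × a < b
firstBelow-just⁻ {b} {R = x ∷ R} eq with x <? b
firstBelow-just⁻ {b} {R = x ∷ R} refl | yes x<b = [] , refl , [] , x<b
... | no x≮b with firstBelow-just⁻ {R = R} eq
...   | pre , refl , b≤pre , a<b = x ∷ pre , refl , ≮⇒≥ x≮b ∷ b≤pre , a<b

firstBelow-just⁺ : ∀ {b a R′} pre → All (b ≤_) pre → a < b → firstBelow b (pre ++ a ∷ R′) ≡ just (a , R′)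
firstBelow-just⁺ {b} {a} [] [] a<b with a <? b
... | yes _ = refl
... | no a≮b = ⊥-elim (a≮b a<b)
firstBelow-just⁺ {b} (x ∷ pre) (b≤x ∷ b≤pre) a<b with x <? b
... | yes x<b = ⊥-elim (<⇒≱ x<b b≤x)
... | no _ = firstBelow-just⁺ pre b≤pre a<b

firstBelow-nothing⁻ : ∀ {b} R → firstBelow b R ≡ nothing → All (b ≤_) R
firstBelow-nothing⁻ [] _ = []
firstBelow-nothing⁻ {b} (x ∷ R) eq with x <? b
firstBelow-nothing⁻ {b} (x ∷ R) () | yes _
... | no x≮b = ≮⇒≥ x≮b ∷ firstBelow-nothing⁻ R eq

firstBelow-exists : ∀ {b v} R → v ∈ R → v < b → ∃₂ λ a R′ → firstBelow b R ≡ just (a , R′)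
firstBelow-exists {b} R v∈ v<b with firstBelow b R in eq
... | just (a , R′) = a , R′ , refl
... | nothing = ⊥-elim (<⇒≱ v<b (All.lookup (firstBelow-nothing⁻ R eq) v∈))

firstBelow-< : ∀ {b a R R′} → firstBelow b R ≡ just (a , R′) → a < b
firstBelow-< {R = R} eq = let _ , _ , _ , a<b = firstBelow-just⁻ {R = R} eq in a<b

firstBelow-∈ : ∀ {b a R R′} → firstBelow b R ≡ just (a , R′) → a ∈ R
firstBelow-∈ {R = R} eq with firstBelow-just⁻ {R = R} eq
... | pre , refl , _ , _ = ∈-++⁺ʳ pre (here refl)

firstBelow-rest-⊆ : ∀ {b a R R′} → firstBelow b R ≡ just (a , R′) → R′ ⊆ R
firstBelow-rest-⊆ {R = R} eq v∈ with firstBelow-just⁻ {R = R} eq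
... | pre , refl , _ , _ = ∈-++⁺ʳ pre (there v∈)

firstBelow-rest-∉ : ∀ {b a R R′} → firstBelow b R ≡ just (a , R′) → Unique R → a ∉ R′
firstBelow-rest-∉ {R = R} eq R! with firstBelow-just⁻ {R = R} eq
... | pre , refl , _ , _ = Unique-++-∷⇒∉ pre R!

firstBelow-later : ∀ {b a R R′} → firstBelow b R ≡ just (a , R′) →
                   ∀ {v} → v ∈ R → v < b → v ≢ a → v ∈ R′
firstBelow-later {R = R} eq v∈ v<b v≢a with firstBelow-just⁻ {R = R} eq
... | pre , refl , b≤pre , _ with ∈-++⁻ pre v∈
...   | inj₁ v∈pre = ⊥-elim (<⇒≱ v<b (All.lookup b≤pre v∈pre))
...   | inj₂ (here v≡a) = ⊥-elim (v≢a v≡a)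
...   | inj₂ (there v∈R′) = v∈R′

firstBelow-map : ∀ {b b′ a c R R′} (π : ℕ → ℕ) → firstBelow b R ≡ just (a , R′) →
                 (∀ {y} → y ∈ R → b ≤ y → b′ ≤ π y) → π a ≡ c → c < b′ →
                 firstBelow b′ (map π R) ≡ just (c , map π R′)
firstBelow-map {b} {b′} {a} {R = R} {R′} π eq π-above refl πa<b′ with firstBelow-just⁻ {R = R} eq
... | pre , refl , b≤pre , _ = begin
  firstBelow b′ (map π (pre ++ a ∷ R′))       ≡⟨ cong (firstBelow b′) (map-++ π pre (a ∷ R′)) ⟩
  firstBelow b′ (map π pre ++ map π (a ∷ R′)) ≡⟨ firstBelow-just⁺ (map π pre) b′≤πpre πa<b′ ⟩
  just (π a , map π R′)                       ∎
  where
    open ≡-Reasoning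
    b′≤πpre : All (b′ ≤_) (map π pre)
    b′≤πpre = All.map⁺ (All.tabulate λ y∈ → π-above (∈-++⁺ˡ y∈) (All.lookup b≤pre y∈))

firstBelow-skip : ∀ {b b′ a c R R₁ R₂} → firstBelow b R ≡ just (a , R₁) → b′ ≤ b → ¬ a < b′ →
                  firstBelow b′ R₁ ≡ just (c , R₂) → firstBelow b′ R ≡ just (c , R₂)
firstBelow-skip {R = R} {R₁} eq b′≤b a≮b′ eq₁
  with firstBelow-just⁻ {R = R} eq | firstBelow-just⁻ {R = R₁} eq₁
... | pre , refl , b≤pre , _ | pre₁ , refl , b′≤pre₁ , c<b′ =
  subst (λ L → firstBelow _ L ≡ just (_ , _)) (++-assoc pre (_ ∷ pre₁) _)
    (firstBelow-just⁺ (pre ++ _ ∷ pre₁) (All.++⁺ (All.map (≤-trans b′≤b) b≤pre) (≮⇒≥ a≮b′ ∷ b′≤pre₁)) c<b′)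

firstBelow-refine : ∀ {b b′ a R R′} → firstBelow b R ≡ just (a , R′) → b′ ≤ b → a < b′ →
                    firstBelow b′ R ≡ just (a , R′)
firstBelow-refine {R = R} eq b′≤b a<b′ with firstBelow-just⁻ {R = R} eq
... | pre , refl , b≤pre , _ = firstBelow-just⁺ pre (All.map (≤-trans b′≤b) b≤pre) a<b′

firstBelow-coarsen : ∀ {b b′ c R R′} → firstBelow b R ≡ just (c , R′) → b ≤ b′ →
                     ∃₂ λ a R₁ → firstBelow b′ R ≡ just (a , R₁) ×
                                 (a ≡ c ⊎ (¬ a < b × firstBelow b R₁ ≡ just (c , R′)))
firstBelow-coarsen {b} {b′} {R = x ∷ R} eq b≤b′ with x <? b | x <? b′
firstBelow-coarsen {R = x ∷ R} refl b≤b′ | yes _ | yes _ = x , R , refl , inj₁ refl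
... | yes x<b | no x≮b′ = ⊥-elim (x≮b′ (<-≤-trans x<b b≤b′))
... | no x≮b | yes _ = x , R , refl , inj₂ (x≮b , eq)
... | no _ | no _ = firstBelow-coarsen {R = R} eq b≤b′

firstBelow-map-fixing : ∀ {b a c R R′} (π : ℕ → ℕ) → (∀ y → b ≤ y → π y ≡ y) →
                        firstBelow b R ≡ just (a , R′) → π a ≡ c → c < b →
                        firstBelow b (map π R) ≡ just (c , map π R′)
firstBelow-map-fixing {b} {R = R} π fixes eq =
  firstBelow-map {R = R} π eq (λ {y} _ b≤y → subst (b ≤_) (sym (fixes y b≤y)) b≤y)

-- Best and second best of a sample

best-≤ : ∀ n s {y} → y ∈ s → best n s ≤ y
best-≤ n (x ∷ s) (here refl) = m⊓n≤m x (best n s)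
best-≤ n (x ∷ s) (there y∈)  = ≤-trans (m⊓n≤n x (best n s)) (best-≤ n s y∈)

best-glb : ∀ n s {c} → c ≤ n → (∀ {y} → y ∈ s → c ≤ y) → c ≤ best n s
best-glb n []      c≤n _   = c≤n
best-glb n (x ∷ s) c≤n c≤s = ⊓-glb (c≤s (here refl)) (best-glb n s c≤n (c≤s ∘ there))

best-≡n⊎∈ : ∀ n s → best n s ≡ n ⊎ best n s ∈ s
best-≡n⊎∈ n [] = inj₁ refl
best-≡n⊎∈ n (x ∷ s) with ⊓-sel x (best n s) | best-≡n⊎∈ n s
... | inj₁ ≡x | _        = inj₂ (here ≡x)
... | inj₂ ≡b | inj₁ b≡n = inj₁ (trans ≡b b≡n)
... | inj₂ ≡b | inj₂ b∈  = inj₂ (subst (_∈ x ∷ s) (sym ≡b) (there b∈))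

best-∈ : ∀ n s {y} → y ∈ s → (∀ {z} → z ∈ s → z < n) → best n s ∈ s
best-∈ n s y∈ s<n with best-≡n⊎∈ n s
... | inj₂ b∈ = b∈
... | inj₁ b≡n = ⊥-elim (<⇒≱ (s<n y∈) (subst (_≤ _) b≡n (best-≤ n s y∈)))

-- b ≤ n is needed because best n [] = n.
record TopTwo (n : ℕ) (s : List ℕ) (a b : ℕ) : Set where
  field
    a<b : a < b
    a∈s : a ∈ s
    b∈s : b ∈ s
    ≡a⊎b≤ : ∀ {y} → y ∈ s → y ≡ a ⊎ b ≤ y
    b≤n : b ≤ n

module _ {n s a b} (top : TopTwo n s a b) where
  open TopTwo top

  TopTwo⇒best≡ : best n s ≡ a
  TopTwo⇒best≡ = ≤-antisym (best-≤ n s a∈s) (best-glb n s (≤-trans (<⇒≤ a<b) b≤n) a≤)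
    where
      a≤ : ∀ {y} → y ∈ s → a ≤ y
      a≤ y∈ with ≡a⊎b≤ y∈
      ... | inj₁ refl = ≤-refl
      ... | inj₂ b≤y  = ≤-trans (<⇒≤ a<b) b≤y

  TopTwo⇒secondBest≡ : secondBest n s ≡ b
  TopTwo⇒secondBest≡ = ≤-antisym (best-≤ n others b∈others) (best-glb n others b≤n b≤)
    where
      P? : Decidable (_≢ best n s)
      P? x = ¬? (x ≟ best n s)
      others : List ℕ
      others = filter P? s
      b∈others : b ∈ others
      b∈others = ∈-filter⁺ P? b∈s λ b≡ → <⇒≢ a<b (trans (sym TopTwo⇒best≡) (sym b≡))
      b≤ : ∀ {y} → y ∈ others → b ≤ y
      b≤ y∈ with ∈-filter⁻ P? y∈
      ... | y∈s , y≢best with ≡a⊎b≤ y∈s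
      ...   | inj₁ refl = ⊥-elim (y≢best (sym TopTwo⇒best≡))
      ...   | inj₂ b≤y  = b≤y

  TopTwo-map : (π : ℕ → ℕ) → (∀ y → b ≤ y → π y ≡ y) → π a < b → TopTwo n (map π s) (π a) b
  TopTwo-map π π-fixes πa<b = record
    { a<b = πa<b ; a∈s = ∈-map⁺ π a∈s ; b∈s = subst (_∈ map π s) (π-fixes b ≤-refl) (∈-map⁺ π b∈s)
    ; ≡a⊎b≤ = ≡πa⊎b≤ ; b≤n = b≤n }
    where
      ≡πa⊎b≤ : ∀ {y} → y ∈ map π s → y ≡ π a ⊎ b ≤ y
      ≡πa⊎b≤ y∈ with ∈-map⁻ π y∈
      ... | x , x∈ , refl with ≡a⊎b≤ x∈
      ...   | inj₁ refl = inj₁ refl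
      ...   | inj₂ b≤x  = inj₂ (subst (b ≤_) (sym (π-fixes x b≤x)) b≤x)

TopTwo-best-secondBest : ∀ n s → 2 ≤ length s → Unique s → (∀ {z} → z ∈ s → z < n) →
                         TopTwo n s (best n s) (secondBest n s)
TopTwo-best-secondBest n s@(x ∷ y ∷ _) _ (x∉ ∷ _) s<n = record
  { a<b = ≤∧≢⇒< (best-≤ n s s₂∈s) (λ e → proj₂ (∈-filter⁻ P? {xs = s} s₂∈others) (sym e))
  ; a∈s = best-∈ n s (here refl) s<n ; b∈s = s₂∈s ; ≡a⊎b≤ = ≡s₁⊎s₂≤ ; b≤n = <⇒≤ (s<n s₂∈s) }
  where
    P? : Decidable (_≢ best n s)
    P? z = ¬? (z ≟ best n s)
    others : List ℕ
    others = filter P? s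
    another : ∃ λ z → z ∈ others
    another with x ≟ best n s
    ... | no x≢ = x , ∈-filter⁺ P? {xs = s} (here refl) x≢
    ... | yes x≡ = y , ∈-filter⁺ P? {xs = s} (there (here refl))
                         λ y≡ → All.lookup x∉ (here refl) (trans x≡ (sym y≡))
    s₂∈others : secondBest n s ∈ others
    s₂∈others = best-∈ n others (proj₂ another) (s<n ∘ proj₁ ∘ ∈-filter⁻ P? {xs = s})
    s₂∈s : secondBest n s ∈ s
    s₂∈s = proj₁ (∈-filter⁻ P? {xs = s} s₂∈others)
    ≡s₁⊎s₂≤ : ∀ {z} → z ∈ s → z ≡ best n s ⊎ secondBest n s ≤ z
    ≡s₁⊎s₂≤ {z} z∈ with z ≟ best n s
    ... | yes z≡ = inj₁ z≡
    ... | no z≢  = inj₂ (best-≤ n others (∈-filter⁺ P? {xs = s} z∈ z≢))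
TopTwo-best-secondBest n (_ ∷ []) (s≤s ()) _ _

-- Relabelling ranks

record Relabelling (n : ℕ) (π : ℕ → ℕ) : Set where
  field
    π⁻¹ : ℕ → ℕ
    π⁻¹∘π : ∀ v → π⁻¹ (π v) ≡ v
    π-< : ∀ {v} → v < n → π v < n

  π-injective : ∀ {u v} → π u ≡ π v → u ≡ v
  π-injective {u} {v} πu≡πv = trans (sym (π⁻¹∘π u)) (trans (cong π⁻¹ πu≡πv) (π⁻¹∘π v))

  map-π⁻¹∘π : ∀ σ → map π⁻¹ (map π σ) ≡ σ
  map-π⁻¹∘π σ = trans (sym (map-∘ σ)) (trans (map-cong π⁻¹∘π σ) (map-id σ))

  IsOrder-map : ∀ {σ} → IsOrder n σ → IsOrder n (map π σ)
  IsOrder-map {σ} o = record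
    { length≡ = trans (length-map π σ) length≡
    ; bounded = λ v∈ → let u , u∈ , v≡πu = ∈-map⁻ π v∈ in subst (_< n) (sym v≡πu) (π-< (bounded u∈))
    ; unique = Unique.map⁺ π-injective unique }
    where open IsOrder o

swap01 : ℕ → ℕ
swap01 0 = 1
swap01 1 = 0
swap01 (suc (suc m)) = suc (suc m)

swap01-involutive : ∀ v → swap01 (swap01 v) ≡ v
swap01-involutive 0 = refl
swap01-involutive 1 = refl
swap01-involutive (suc (suc m)) = refl

swap01-fixes : ∀ {v} → 2 ≤ v → swap01 v ≡ v
swap01-fixes {suc (suc m)} _ = refl
swap01-fixes {1} (s≤s ())

swap01-relabelling : ∀ {n} → 1 < n → Relabelling n swap01
swap01-relabelling {n} 1<n = record { π⁻¹ = swap01 ; π⁻¹∘π = swap01-involutive ; π-< = swap01-< }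
  where
    swap01-< : ∀ {v} → v < n → swap01 v < n
    swap01-< {0} _ = 1<n
    swap01-< {1} _ = <-trans (s≤s z≤n) 1<n
    swap01-< {suc (suc m)} v<n = v<n

cycle : ℕ → ℕ → ℕ → ℕ → ℕ
cycle x y z v with v ≟ x
... | yes _ = y
... | no _ with v ≟ y
...   | yes _ = z
...   | no _ with v ≟ z
...     | yes _ = x
...     | no _ = v

cycle-x : ∀ x y z → cycle x y z x ≡ y
cycle-x x y z with x ≟ x
... | yes _ = refl
... | no x≢x = ⊥-elim (x≢x refl)

cycle-y : ∀ {x y z} → x ≢ y → cycle x y z y ≡ z
cycle-y {x} {y} x≢y with y ≟ x
... | yes y≡x = ⊥-elim (x≢y (sym y≡x))
... | no _ with y ≟ y
...   | yes _ = refl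
...   | no y≢y = ⊥-elim (y≢y refl)

cycle-z : ∀ {x y z} → x ≢ z → y ≢ z → cycle x y z z ≡ x
cycle-z {x} {y} {z} x≢z y≢z with z ≟ x
... | yes z≡x = ⊥-elim (x≢z (sym z≡x))
... | no _ with z ≟ y
...   | yes z≡y = ⊥-elim (y≢z (sym z≡y))
...   | no _ with z ≟ z
...     | yes _ = refl
...     | no z≢z = ⊥-elim (z≢z refl)

cycle-fixes : ∀ {x y z v} → v ≢ x → v ≢ y → v ≢ z → cycle x y z v ≡ v
cycle-fixes {x} {y} {z} {v} v≢x v≢y v≢z with v ≟ x
... | yes v≡x = ⊥-elim (v≢x v≡x)
... | no _ with v ≟ y
...   | yes v≡y = ⊥-elim (v≢y v≡y)
...   | no _ with v ≟ z
...     | yes v≡z = ⊥-elim (v≢z v≡z)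
...     | no _ = refl

cycle-fixes-> : ∀ {x y z v} → x < v → y < v → z < v → cycle x y z v ≡ v
cycle-fixes-> x<v y<v z<v = cycle-fixes (>⇒≢ x<v) (>⇒≢ y<v) (>⇒≢ z<v)

cycle-relabelling : ∀ {n x y z} → x ≢ y → y ≢ z → x ≢ z → x < n → y < n → z < n →
                    Relabelling n (cycle x y z)
cycle-relabelling {n} {x} {y} {z} x≢y y≢z x≢z x<n y<n z<n =
  record { π⁻¹ = cycle x z y ; π⁻¹∘π = λ v → inverse v (v ≟ x) (v ≟ y) (v ≟ z) ; π-< = cycle-< }
  where
    z≢y : z ≢ y
    z≢y = ≢-sym y≢z
    inverse : ∀ v → Dec (v ≡ x) → Dec (v ≡ y) → Dec (v ≡ z) → cycle x z y (cycle x y z v) ≡ v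
    inverse v (yes refl) _ _ = trans (cong (cycle x z y) (cycle-x x y z)) (cycle-z x≢y z≢y)
    inverse v (no _) (yes refl) _ = trans (cong (cycle x z y) (cycle-y x≢y)) (cycle-y x≢z)
    inverse v (no _) (no _) (yes refl) = trans (cong (cycle x z y) (cycle-z x≢z y≢z)) (cycle-x x z y)
    inverse v (no v≢x) (no v≢y) (no v≢z) =
      trans (cong (cycle x z y) (cycle-fixes v≢x v≢y v≢z)) (cycle-fixes v≢x v≢z v≢y)
    cycle-< : ∀ {v} → v < n → cycle x y z v < n
    cycle-< {v} v<n with v ≟ x
    ... | yes _ = y<n
    ... | no _ with v ≟ y
    ...   | yes _ = z<n
    ...   | no _ with v ≟ z
    ...     | yes _ = x<n
    ...     | no _ = v<n

-- The bijection between the two events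

module AcceptanceEvents (n t : ℕ) where

  private
    k : ℕ
    k = t ∸ 1

  single-accepts-v1⁺ : ∀ τ {b R R′} → best n (take k τ) ≡ b → drop k τ ≡ R →
                       firstBelow b R ≡ just (0 , R′) → Single-accepts-v1 n t τ
  single-accepts-v1⁺ τ refl refl eq with firstBelow (best n (take k τ)) (drop k τ)
  single-accepts-v1⁺ τ refl refl refl | just _ = refl

  single-accepts-v1⁻ : ∀ σ → Single-accepts-v1 n t σ →
                       ∃ λ R′ → firstBelow (best n (take k σ)) (drop k σ) ≡ just (0 , R′)
  single-accepts-v1⁻ σ acc with firstBelow (best n (take k σ)) (drop k σ)
  single-accepts-v1⁻ σ refl | just (.0 , R′) = R′ , refl

  opt-accepts-v2-first⁺ : ∀ τ {b₂ R R₁} → secondBest n (take k τ) ≡ b₂ → drop k τ ≡ R →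
                          firstBelow b₂ R ≡ just (1 , R₁) → Opt-accepts-v2 n t τ
  opt-accepts-v2-first⁺ τ refl refl eq with firstBelow (secondBest n (take k τ)) (drop k τ)
  opt-accepts-v2-first⁺ τ refl refl refl | just (_ , R₁) with firstBelow (best n (take k τ)) R₁
  ... | nothing = here refl
  ... | just _  = here refl

  opt-accepts-v2-second⁺ : ∀ τ {b₁ b₂ R a R₁ R₂} → best n (take k τ) ≡ b₁ → secondBest n (take k τ) ≡ b₂ →
                           drop k τ ≡ R → firstBelow b₂ R ≡ just (a , R₁) → firstBelow b₁ R₁ ≡ just (1 , R₂) →
                           Opt-accepts-v2 n t τ
  opt-accepts-v2-second⁺ τ refl refl refl eq eq₁ with firstBelow (secondBest n (take k τ)) (drop k τ)
  opt-accepts-v2-second⁺ τ {R₁ = R₁} refl refl refl refl eq₁ | just _ with firstBelow (best n (take k τ)) R₁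
  opt-accepts-v2-second⁺ τ refl refl refl refl refl | just _ | just _ = there (here refl)

  opt-accepts-v2⁻ : ∀ σ → Opt-accepts-v2 n t σ →
                    ∃₂ λ a R₁ → firstBelow (secondBest n (take k σ)) (drop k σ) ≡ just (a , R₁) ×
                                (a ≡ 1 ⊎ ∃ λ R₂ → firstBelow (best n (take k σ)) R₁ ≡ just (1 , R₂))
  opt-accepts-v2⁻ σ acc with firstBelow (secondBest n (take k σ)) (drop k σ)
  opt-accepts-v2⁻ σ () | nothing
  ... | just (a , R₁) with firstBelow (best n (take k σ)) R₁ in eq₁
  opt-accepts-v2⁻ σ (here refl)         | just (a , R₁) | nothing      = a , R₁ , refl , inj₁ refl
  opt-accepts-v2⁻ σ (here refl)         | just (a , R₁) | just _       = a , R₁ , refl , inj₁ refl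
  opt-accepts-v2⁻ σ (there (here refl)) | just (a , R₁) | just (_ , R₂) = a , R₁ , refl , inj₂ (R₂ , eq₁)

≢0∧≢1⇒2≤ : ∀ {x} → x ≢ 0 → x ≢ 1 → 2 ≤ x
≢0∧≢1⇒2≤ {0} x≢0 _ = ⊥-elim (x≢0 refl)
≢0∧≢1⇒2≤ {1} _ x≢1 = ⊥-elim (x≢1 refl)
≢0∧≢1⇒2≤ {suc (suc x)} _ _ = s≤s (s≤s z≤n)

forward-relabelling : ℕ → ℕ → List ℕ → ℕ → ℕ
forward-relabelling s₁ s₂ r with s₁ ≟ 1
... | no _ = swap01
... | yes _ with firstBelow s₂ r
...   | nothing = swap01
...   | just (d , r₁) with d ≟ 0
...     | yes _ = swap01
...     | no _ with firstBelow d r₁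
...       | nothing = swap01
...       | just (e , _) = cycle 1 d e

backward-relabelling : ℕ → ℕ → List ℕ → ℕ → ℕ
backward-relabelling s₁ s₂ r with s₁ ≟ 0
... | yes _ = swap01
... | no _ with firstBelow s₂ r
...   | nothing = swap01
...   | just (a , _) with a <? s₁
...     | no _ = swap01
...     | yes _ with a ≟ 1
...       | yes _ = swap01
...       | no _ = cycle 1 a s₁

forward-relabelling-≢1 : ∀ {s₁} s₂ r → s₁ ≢ 1 → forward-relabelling s₁ s₂ r ≡ swap01
forward-relabelling-≢1 {s₁} s₂ r s₁≢1 with s₁ ≟ 1
... | yes s₁≡1 = ⊥-elim (s₁≢1 s₁≡1)
... | no _ = refl

forward-relabelling-0 : ∀ {s₁ s₂ r r₁} → s₁ ≡ 1 → firstBelow s₂ r ≡ just (0 , r₁) →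
                        forward-relabelling s₁ s₂ r ≡ swap01
forward-relabelling-0 refl eq rewrite eq = refl

forward-relabelling-cycle : ∀ {s₁ s₂ r d r₁ e r₂} → s₁ ≡ 1 → firstBelow s₂ r ≡ just (d , r₁) → d ≢ 0 →
                            firstBelow d r₁ ≡ just (e , r₂) → forward-relabelling s₁ s₂ r ≡ cycle 1 d e
forward-relabelling-cycle {d = d} refl eq d≢0 eq₁ rewrite eq with d ≟ 0
... | yes d≡0 = ⊥-elim (d≢0 d≡0)
... | no _ rewrite eq₁ = refl

backward-relabelling-0 : ∀ {s₁} s₂ r → s₁ ≡ 0 → backward-relabelling s₁ s₂ r ≡ swap01
backward-relabelling-0 s₂ r refl = refl

backward-relabelling-swap : ∀ {s₁ s₂ r a r₁} → s₁ ≢ 0 → firstBelow s₂ r ≡ just (a , r₁) →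
                            ¬ a < s₁ ⊎ a ≡ 1 → backward-relabelling s₁ s₂ r ≡ swap01
backward-relabelling-swap {s₁} {a = a} s₁≢0 eq a≮s₁⊎a≡1 with s₁ ≟ 0
... | yes s₁≡0 = ⊥-elim (s₁≢0 s₁≡0)
... | no _ rewrite eq with a <? s₁
...   | no _ = refl
...   | yes a<s₁ with a ≟ 1
...     | yes _ = refl
...     | no a≢1 with a≮s₁⊎a≡1
...       | inj₁ a≮s₁ = ⊥-elim (a≮s₁ a<s₁)
...       | inj₂ a≡1 = ⊥-elim (a≢1 a≡1)

backward-relabelling-cycle : ∀ {s₁ s₂ r a r₁} → s₁ ≢ 0 → firstBelow s₂ r ≡ just (a , r₁) → a < s₁ → a ≢ 1 →
                             backward-relabelling s₁ s₂ r ≡ cycle 1 a s₁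
backward-relabelling-cycle {s₁} {a = a} s₁≢0 eq a<s₁ a≢1 with s₁ ≟ 0
... | yes s₁≡0 = ⊥-elim (s₁≢0 s₁≡0)
... | no _ rewrite eq with a <? s₁
...   | no a≮s₁ = ⊥-elim (a≮s₁ a<s₁)
...   | yes _ with a ≟ 1
...     | yes a≡1 = ⊥-elim (a≢1 a≡1)
...     | no _ = refl

module Bijection (n t : ℕ) (2≤k : 2 ≤ t ∸ 1) (k≤n : t ∸ 1 ≤ n) where

  open AcceptanceEvents n t

  private
    k : ℕ
    k = t ∸ 1

  forward backward : List ℕ → List ℕ
  forward σ = map (forward-relabelling (best n (take k σ)) (secondBest n (take k σ)) (drop k σ)) σ
  backward σ = map (backward-relabelling (best n (take k σ)) (secondBest n (take k σ)) (drop k σ)) σ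

  Sends : (f g : List ℕ → List ℕ) → (List ℕ → Set) → List ℕ → Set
  Sends f g Q σ = f σ ∈ orders n × Q (f σ) × g (f σ) ≡ σ

  sends : ∀ f g Q {σ τ} → f σ ≡ τ → IsOrder n τ → Q τ → g τ ≡ σ → Sends f g Q σ
  sends f g Q refl o acc back = ∈-orders⁺ n o , acc , back

  forward-≡ : ∀ τ {b₁ b₂ R} → best n (take k τ) ≡ b₁ → secondBest n (take k τ) ≡ b₂ → drop k τ ≡ R →
              forward τ ≡ map (forward-relabelling b₁ b₂ R) τ
  forward-≡ τ refl refl refl = refl

  backward-≡ : ∀ τ {b₁ b₂ R} → best n (take k τ) ≡ b₁ → secondBest n (take k τ) ≡ b₂ → drop k τ ≡ R →
               backward τ ≡ map (backward-relabelling b₁ b₂ R) τ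
  backward-≡ τ refl refl refl = refl

  1<n : 1 < n
  1<n = ≤-trans 2≤k k≤n

  below-best⇒∈post : ∀ {τ} → IsOrder n τ → ∀ {v} → v < n → v < best n (take k τ) → v ∈ drop k τ
  below-best⇒∈post {τ} o v<n v<best
    with ∈-++⁻ (take k τ) (subst (_ ∈_) (sym (take++drop≡id k τ)) (IsOrder-complete o v<n))
  ... | inj₁ v∈s = ⊥-elim (<⇒≱ v<best (best-≤ n (take k τ) v∈s))
  ... | inj₂ v∈r = v∈r

  module Sample {σ} (o : IsOrder n σ) where
    open IsOrder o

    s r : List ℕ
    s = take k σ
    r = drop k σ

    s₁ s₂ : ℕ
    s₁ = best n s
    s₂ = secondBest n s

    s++r≡σ : s ++ r ≡ σ
    s++r≡σ = take++drop≡id k σ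

    s-r-disjoint : Disjoint s r
    s-r-disjoint = Unique-++⇒Disjoint s (subst Unique (sym s++r≡σ) unique)

    r-unique : Unique r
    r-unique = Unique.drop⁺ k unique

    s⊆σ : s ⊆ σ
    s⊆σ v∈ = subst (_ ∈_) s++r≡σ (∈-++⁺ˡ v∈)

    r⊆σ : r ⊆ σ
    r⊆σ v∈ = subst (_ ∈_) s++r≡σ (∈-++⁺ʳ s v∈)

    top : TopTwo n s s₁ s₂
    top = TopTwo-best-secondBest n s 2≤|s| (Unique.take⁺ k unique)
            (bounded ∘ s⊆σ)
      where
        2≤|s| : 2 ≤ length s
        2≤|s| = subst (2 ≤_) (sym (trans (length-take k σ) (trans (cong (k ⊓_) length≡) (m≤n⇒m⊓n≡m k≤n)))) 2≤k

    open TopTwo top public using () renaming (a<b to s₁<s₂; a∈s to s₁∈s; b∈s to s₂∈s; ≡a⊎b≤ to ≡s₁⊎s₂≤)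

    0<s₂ : 0 < s₂
    0<s₂ = <-≤-trans (s≤s z≤n) s₁<s₂

    sample≢post : ∀ {u v} → u ∈ s → v ∈ r → u ≢ v
    sample≢post u∈ v∈ refl = s-r-disjoint (u∈ , v∈)

    module Relabelled {π} (ρ : Relabelling n π) (fixes : ∀ y → s₂ ≤ y → π y ≡ y)
                      {b₁} (πs₁≡b₁ : π s₁ ≡ b₁) (b₁<s₂ : b₁ < s₂) where
      open Relabelling ρ

      τ : List ℕ
      τ = map π σ

      τ-top : TopTwo n (take k τ) b₁ s₂
      τ-top = subst₂ (λ L x → TopTwo n L x s₂) (sym (take-map k σ)) πs₁≡b₁
                (TopTwo-map top π fixes (subst (_< s₂) (sym πs₁≡b₁) b₁<s₂))

      τ-best : best n (take k τ) ≡ b₁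
      τ-best = TopTwo⇒best≡ τ-top

      τ-secondBest : secondBest n (take k τ) ≡ s₂
      τ-secondBest = TopTwo⇒secondBest≡ τ-top

      τ-order : IsOrder n τ
      τ-order = IsOrder-map o

      τ-post : drop k τ ≡ map π r
      τ-post = drop-map k σ

      forward-sends : forward-relabelling s₁ s₂ r ≡ π → Opt-accepts-v2 n t τ →
                      backward-relabelling b₁ s₂ (map π r) ≡ π⁻¹ →
                      Sends forward backward (Opt-accepts-v2 n t) σ
      forward-sends forth acc back =
        sends forward backward (Opt-accepts-v2 n t) (cong (λ f → map f σ) forth) τ-order acc (begin
        backward τ                                        ≡⟨ backward-≡ τ τ-best τ-secondBest τ-post ⟩
        map (backward-relabelling b₁ s₂ (map π r)) τ     ≡⟨ cong (λ f → map f τ) back ⟩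
        map π⁻¹ τ                                         ≡⟨ map-π⁻¹∘π σ ⟩
        σ                                                 ∎)
        where open ≡-Reasoning

      backward-sends : backward-relabelling s₁ s₂ r ≡ π → Single-accepts-v1 n t τ →
                       forward-relabelling b₁ s₂ (map π r) ≡ π⁻¹ →
                       Sends backward forward (Single-accepts-v1 n t) σ
      backward-sends back acc forth =
        sends backward forward (Single-accepts-v1 n t) (cong (λ f → map f σ) back) τ-order acc (begin
        forward τ                                         ≡⟨ forward-≡ τ τ-best τ-secondBest τ-post ⟩
        map (forward-relabelling b₁ s₂ (map π r)) τ      ≡⟨ cong (λ f → map f τ) forth ⟩
        map π⁻¹ τ                                         ≡⟨ map-π⁻¹∘π σ ⟩
        σ                                                 ∎)
        where open ≡-Reasoning

    forward-sends-≢1 : ∀ {r₀} → firstBelow s₁ r ≡ just (0 , r₀) → s₁ ≢ 1 →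
                       Sends forward backward (Opt-accepts-v2 n t) σ
    forward-sends-≢1 {r₀} eq₀ s₁≢1 =
      forward-sends (forward-relabelling-≢1 s₂ r s₁≢1) (proj₁ accepts×back) (proj₂ accepts×back)
      where
        s₁≢0 : s₁ ≢ 0
        s₁≢0 = sample≢post s₁∈s (firstBelow-∈ {R = r} eq₀)
        2≤s₁ : 2 ≤ s₁
        2≤s₁ = ≢0∧≢1⇒2≤ s₁≢0 s₁≢1
        fixes-s₁ : ∀ y → s₁ ≤ y → swap01 y ≡ y
        fixes-s₁ y s₁≤y = swap01-fixes (≤-trans 2≤s₁ s₁≤y)
        open Relabelled (swap01-relabelling 1<n) (λ y s₂≤y → fixes-s₁ y (≤-trans (<⇒≤ s₁<s₂) s₂≤y))
                        (fixes-s₁ s₁ ≤-refl) s₁<s₂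
        -- item 1 now plays the role of 0; raising the threshold to s₂ accepts it first or second
        accepts×back : Opt-accepts-v2 n t τ × backward-relabelling s₁ s₂ (map swap01 r) ≡ swap01
        accepts×back with firstBelow-coarsen {R = map swap01 r}
                            (firstBelow-map-fixing {R = r} swap01 fixes-s₁ eq₀ refl 2≤s₁) (<⇒≤ s₁<s₂)
        ... | _ , _ , eqa , inj₁ refl =
          opt-accepts-v2-first⁺ τ τ-secondBest τ-post eqa ,
          backward-relabelling-swap s₁≢0 eqa (inj₂ refl)
        ... | _ , _ , eqa , inj₂ (a≮s₁ , eq₁) =
          opt-accepts-v2-second⁺ τ τ-best τ-secondBest τ-post eqa eq₁ ,
          backward-relabelling-swap s₁≢0 eqa (inj₁ a≮s₁)

    forward-sends-0 : ∀ {r₁} → s₁ ≡ 1 → firstBelow s₂ r ≡ just (0 , r₁) →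
                      Sends forward backward (Opt-accepts-v2 n t) σ
    forward-sends-0 {r₁} s₁≡1 eq₀ =
      forward-sends (forward-relabelling-0 s₁≡1 eq₀)
                    (opt-accepts-v2-first⁺ τ τ-secondBest τ-post eq₁)
                    (backward-relabelling-0 s₂ (map swap01 r) refl)
      where
        2≤s₂ : 2 ≤ s₂
        2≤s₂ = subst (_< s₂) s₁≡1 s₁<s₂
        fixes-s₂ : ∀ y → s₂ ≤ y → swap01 y ≡ y
        fixes-s₂ y s₂≤y = swap01-fixes (≤-trans 2≤s₂ s₂≤y)
        open Relabelled (swap01-relabelling 1<n) fixes-s₂ (cong swap01 s₁≡1) (<-trans (s≤s z≤n) 2≤s₂)
        eq₁ : firstBelow s₂ (map swap01 r) ≡ just (1 , map swap01 r₁)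
        eq₁ = firstBelow-map-fixing {R = r} swap01 fixes-s₂ eq₀ refl 2≤s₂

    forward-sends-cycle : ∀ {d e r₁ r₂} → s₁ ≡ 1 → firstBelow s₂ r ≡ just (d , r₁) → d ≢ 0 →
                          firstBelow d r₁ ≡ just (e , r₂) → Sends forward backward (Opt-accepts-v2 n t) σ
    forward-sends-cycle {d} {e} {r₁} {r₂} s₁≡1 eqd d≢0 eqe =
      forward-sends (forward-relabelling-cycle s₁≡1 eqd d≢0 eqe)
                    (opt-accepts-v2-second⁺ τ τ-best τ-secondBest τ-post eqτ₁ eqτ₂)
                    (backward-relabelling-cycle d≢0 eqτ₁ e<d (≢-sym 1≢e))
      where
        1∈s : 1 ∈ s
        1∈s = subst (_∈ s) s₁≡1 s₁∈s
        d∈r : d ∈ r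
        d∈r = firstBelow-∈ {R = r} eqd
        e∈r : e ∈ r
        e∈r = firstBelow-rest-⊆ {R = r} eqd (firstBelow-∈ {R = r₁} eqe)
        1≢d : 1 ≢ d
        1≢d = sample≢post 1∈s d∈r
        1≢e : 1 ≢ e
        1≢e = sample≢post 1∈s e∈r
        d<s₂ : d < s₂
        d<s₂ = firstBelow-< {R = r} eqd
        e<d : e < d
        e<d = firstBelow-< {R = r₁} eqe
        d≢e : d ≢ e
        d≢e = >⇒≢ e<d
        1<d : 1 < d
        1<d = ≢0∧≢1⇒2≤ d≢0 (≢-sym 1≢d)
        fixes-s₂ : ∀ y → s₂ ≤ y → cycle 1 d e y ≡ y
        fixes-s₂ y s₂≤y = cycle-fixes-> (<-trans 1<d d<y) d<y (<-trans e<d d<y)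
          where
            d<y : d < y
            d<y = <-≤-trans d<s₂ s₂≤y
        open Relabelled (cycle-relabelling 1≢d d≢e 1≢e 1<n (bounded (r⊆σ d∈r)) (bounded (r⊆σ e∈r)))
                        fixes-s₂ (trans (cong (cycle 1 d e) s₁≡1) (cycle-x 1 d e)) d<s₂
        eqτ₁ : firstBelow s₂ (map (cycle 1 d e) r) ≡ just (e , map (cycle 1 d e) r₁)
        eqτ₁ = firstBelow-map-fixing {R = r} (cycle 1 d e) fixes-s₂ eqd (cycle-y 1≢d) (<-trans e<d d<s₂)
        d≤cycle : ∀ {y} → y ∈ r₁ → d ≤ y → d ≤ cycle 1 d e y
        d≤cycle {y} y∈ d≤y = subst (d ≤_) (sym (cycle-fixes y≢1 y≢d (>⇒≢ (<-≤-trans e<d d≤y)))) d≤y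
          where
            y≢1 : y ≢ 1
            y≢1 = ≢-sym (sample≢post 1∈s (firstBelow-rest-⊆ {R = r} eqd y∈))
            y≢d : y ≢ d
            y≢d refl = firstBelow-rest-∉ {R = r} eqd r-unique y∈
        eqτ₂ : firstBelow d (map (cycle 1 d e) r₁) ≡ just (1 , map (cycle 1 d e) r₂)
        eqτ₂ = firstBelow-map {R = r₁} (cycle 1 d e) eqe d≤cycle (cycle-z 1≢e d≢e) 1<d

    forward-sends-1 : s₁ ≡ 1 → 0 ∈ r → Sends forward backward (Opt-accepts-v2 n t) σ
    forward-sends-1 s₁≡1 0∈r with firstBelow-exists r 0∈r 0<s₂
    ... | d , r₁ , eqd with d ≟ 0
    ...   | yes refl = forward-sends-0 s₁≡1 eqd
    ...   | no d≢0 with firstBelow-exists r₁ (firstBelow-later {R = r} eqd 0∈r 0<s₂ (≢-sym d≢0)) (n≢0⇒n>0 d≢0)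
    ...     | e , r₂ , eqe = forward-sends-cycle s₁≡1 eqd d≢0 eqe

    single-accepts-v1⇒forward-sends : Single-accepts-v1 n t σ → Sends forward backward (Opt-accepts-v2 n t) σ
    single-accepts-v1⇒forward-sends acc with single-accepts-v1⁻ σ acc
    ... | r₀ , eq₀ = by-best (s₁ ≟ 1)
      where
        by-best : Dec (s₁ ≡ 1) → Sends forward backward (Opt-accepts-v2 n t) σ
        by-best (no s₁≢1)  = forward-sends-≢1 eq₀ s₁≢1
        by-best (yes s₁≡1) = forward-sends-1 s₁≡1 (firstBelow-∈ {R = r} eq₀)

    backward-sends-0 : ∀ {r₁} → s₁ ≡ 0 → firstBelow s₂ r ≡ just (1 , r₁) →
                       Sends backward forward (Single-accepts-v1 n t) σ
    backward-sends-0 {r₁} s₁≡0 eq₁ =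
      backward-sends (backward-relabelling-0 s₂ r s₁≡0)
                     (single-accepts-v1⁺ τ τ-best τ-post eq₀)
                     (forward-relabelling-0 {r = map swap01 r} refl
                        (firstBelow-map-fixing {R = r} swap01 fixes-s₂ eq₁ refl 0<s₂))
      where
        2≤s₂ : 2 ≤ s₂
        2≤s₂ = ≢0∧≢1⇒2≤ (>⇒≢ 0<s₂) (sample≢post s₂∈s (firstBelow-∈ {R = r} eq₁))
        fixes-s₂ : ∀ y → s₂ ≤ y → swap01 y ≡ y
        fixes-s₂ y s₂≤y = swap01-fixes (≤-trans 2≤s₂ s₂≤y)
        open Relabelled (swap01-relabelling 1<n) fixes-s₂ (cong swap01 s₁≡0) 2≤s₂
        1≤swap01 : ∀ {y} → y ∈ r → s₂ ≤ y → 1 ≤ swap01 y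
        1≤swap01 {y} _ s₂≤y = subst (1 ≤_) (sym (fixes-s₂ y s₂≤y)) (≤-trans (s≤s z≤n) (≤-trans 2≤s₂ s₂≤y))
        eq₀ : firstBelow 1 (map swap01 r) ≡ just (0 , map swap01 r₁)
        eq₀ = firstBelow-map {R = r} swap01 eq₁ 1≤swap01 refl (s≤s z≤n)

    backward-sends-swap : ∀ {a r₁ R} → s₁ ≢ 0 → firstBelow s₂ r ≡ just (a , r₁) → ¬ a < s₁ ⊎ a ≡ 1 →
                          firstBelow s₁ r ≡ just (1 , R) → Sends backward forward (Single-accepts-v1 n t) σ
    backward-sends-swap s₁≢0 eqa a≮s₁⊎a≡1 eq₁ =
      backward-sends (backward-relabelling-swap s₁≢0 eqa a≮s₁⊎a≡1)
                     (single-accepts-v1⁺ τ τ-best τ-post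
                        (firstBelow-map-fixing {R = r} swap01 fixes-s₁ eq₁ refl (<-trans (s≤s z≤n) 2≤s₁)))
                     (forward-relabelling-≢1 s₂ (map swap01 r) s₁≢1)
      where
        s₁≢1 : s₁ ≢ 1
        s₁≢1 = sample≢post s₁∈s (firstBelow-∈ {R = r} eq₁)
        2≤s₁ : 2 ≤ s₁
        2≤s₁ = ≢0∧≢1⇒2≤ s₁≢0 s₁≢1
        fixes-s₁ : ∀ y → s₁ ≤ y → swap01 y ≡ y
        fixes-s₁ y s₁≤y = swap01-fixes (≤-trans 2≤s₁ s₁≤y)
        open Relabelled (swap01-relabelling 1<n) (λ y s₂≤y → fixes-s₁ y (≤-trans (<⇒≤ s₁<s₂) s₂≤y))
                        (fixes-s₁ s₁ ≤-refl) s₁<s₂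

    backward-sends-cycle : ∀ {a r₁ r₂} → s₁ ≢ 0 → firstBelow s₂ r ≡ just (a , r₁) → a < s₁ → a ≢ 1 →
                           firstBelow s₁ r₁ ≡ just (1 , r₂) → Sends backward forward (Single-accepts-v1 n t) σ
    backward-sends-cycle {a} {r₁} {r₂} s₁≢0 eqa a<s₁ a≢1 eq₁ =
      backward-sends (backward-relabelling-cycle s₁≢0 eqa a<s₁ a≢1) τ-accepts
                     (forward-relabelling-cycle {r = map (cycle 1 a s₁) r} refl eqτ₁ s₁≢0 eqτ₂)
      where
        a∈r : a ∈ r
        a∈r = firstBelow-∈ {R = r} eqa
        1≢s₁ : 1 ≢ s₁
        1≢s₁ = ≢-sym (sample≢post s₁∈s (firstBelow-rest-⊆ {R = r} eqa (firstBelow-∈ {R = r₁} eq₁)))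
        1<s₁ : 1 < s₁
        1<s₁ = ≢0∧≢1⇒2≤ s₁≢0 (≢-sym 1≢s₁)
        1≢a : 1 ≢ a
        1≢a = ≢-sym a≢1
        a≢s₁ : a ≢ s₁
        a≢s₁ = <⇒≢ a<s₁
        fixes-s₂ : ∀ y → s₂ ≤ y → cycle 1 a s₁ y ≡ y
        fixes-s₂ y s₂≤y = cycle-fixes-> (<-trans 1<s₁ s₁<y) (<-trans a<s₁ s₁<y) s₁<y
          where
            s₁<y : s₁ < y
            s₁<y = <-≤-trans s₁<s₂ s₂≤y
        open Relabelled (cycle-relabelling 1≢a a≢s₁ 1≢s₁ 1<n (bounded (r⊆σ a∈r)) (bounded (s⊆σ s₁∈s)))
                        fixes-s₂ (cycle-z 1≢s₁ a≢s₁) (<-trans 1<s₁ s₁<s₂)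
        -- τ has sample best 1, so item 0 arrives after the sample and is the first one below 1
        0∈post : 0 ∈ drop k τ
        0∈post = below-best⇒∈post τ-order (<-trans (s≤s z≤n) 1<n) (subst (0 <_) (sym τ-best) (s≤s z≤n))
        τ-accepts : Single-accepts-v1 n t τ
        τ-accepts with firstBelow-exists (drop k τ) 0∈post (s≤s z≤n)
        ... | c , R′ , eqc with firstBelow-< {R = drop k τ} eqc
        ...   | s≤s z≤n = single-accepts-v1⁺ τ τ-best refl eqc
        eqτ₁ : firstBelow s₂ (map (cycle 1 a s₁) r) ≡ just (s₁ , map (cycle 1 a s₁) r₁)
        eqτ₁ = firstBelow-map-fixing {R = r} (cycle 1 a s₁) fixes-s₂ eqa (cycle-y 1≢a) s₁<s₂
        s₁≤cycle : ∀ {y} → y ∈ r₁ → s₁ ≤ y → s₁ ≤ cycle 1 a s₁ y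
        s₁≤cycle {y} y∈ s₁≤y = subst (s₁ ≤_) (sym (cycle-fixes y≢1 y≢a y≢s₁)) s₁≤y
          where
            y≢1 : y ≢ 1
            y≢1 = >⇒≢ (<-≤-trans 1<s₁ s₁≤y)
            y≢a : y ≢ a
            y≢a = >⇒≢ (<-≤-trans a<s₁ s₁≤y)
            y≢s₁ : y ≢ s₁
            y≢s₁ = ≢-sym (sample≢post s₁∈s (firstBelow-rest-⊆ {R = r} eqa y∈))
        eqτ₂ : firstBelow s₁ (map (cycle 1 a s₁) r₁) ≡ just (a , map (cycle 1 a s₁) r₂)
        eqτ₂ = firstBelow-map {R = r₁} (cycle 1 a s₁) eq₁ s₁≤cycle (cycle-x 1 a s₁) a<s₁

    backward-sends-by-cases : ∀ {a r₁} → firstBelow s₂ r ≡ just (a , r₁) →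
                              a ≡ 1 ⊎ (∃ λ r₂ → firstBelow s₁ r₁ ≡ just (1 , r₂)) →
                              Dec (s₁ ≡ 0) → Dec (a < s₁) → Dec (a ≡ 1) →
                              Sends backward forward (Single-accepts-v1 n t) σ
    backward-sends-by-cases eqa (inj₁ refl) (yes s₁≡0) _ _ = backward-sends-0 s₁≡0 eqa
    backward-sends-by-cases {r₁ = r₁} eqa (inj₂ (_ , eq₁)) (yes s₁≡0) _ _ =
      ⊥-elim (<⇒≱ (firstBelow-< {R = r₁} eq₁) (subst (_≤ 1) (sym s₁≡0) z≤n))
    backward-sends-by-cases eqa (inj₂ (_ , eq₁)) (no s₁≢0) (yes a<s₁) (no a≢1) =
      backward-sends-cycle s₁≢0 eqa a<s₁ a≢1 eq₁
    backward-sends-by-cases eqa (inj₁ refl) (no _) (yes _) (no 1≢1) = ⊥-elim (1≢1 refl)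
    backward-sends-by-cases eqa _ (no s₁≢0) (yes a<s₁) (yes refl) =
      backward-sends-swap s₁≢0 eqa (inj₂ refl) (firstBelow-refine {R = r} eqa (<⇒≤ s₁<s₂) a<s₁)
    backward-sends-by-cases eqa (inj₁ refl) (no s₁≢0) (no 1≮s₁) _ =
      ⊥-elim (1≮s₁ (≢0∧≢1⇒2≤ s₁≢0 (sample≢post s₁∈s (firstBelow-∈ {R = r} eqa))))
    backward-sends-by-cases eqa (inj₂ (_ , eq₁)) (no s₁≢0) (no a≮s₁) _ =
      backward-sends-swap s₁≢0 eqa (inj₁ a≮s₁) (firstBelow-skip {R = r} eqa (<⇒≤ s₁<s₂) a≮s₁ eq₁)

    opt-accepts-v2⇒backward-sends : Opt-accepts-v2 n t σ → Sends backward forward (Single-accepts-v1 n t) σ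
    opt-accepts-v2⇒backward-sends acc with opt-accepts-v2⁻ σ acc
    ... | a , _ , eqa , accepted = backward-sends-by-cases eqa accepted (s₁ ≟ 0) (a <? s₁) (a ≟ 1)

  theorem : count (Opt-accepts-v2? n t) (orders n) ≡ count (Single-accepts-v1? n t) (orders n)
  theorem = count-≡-bijection (Opt-accepts-v2? n t) (Single-accepts-v1? n t) (orders-unique n) backward forward
              (λ σ∈ → Sample.opt-accepts-v2⇒backward-sends (∈-orders⁻ n σ∈))
              (λ σ∈ → Sample.single-accepts-v1⇒forward-sends (∈-orders⁻ n σ∈))

lemma12 : (n t : ℕ) → 5 ≤ n → 2 < t → t ≤ n ∸ 2 →
            count (Opt-accepts-v2? n t) (orders n) ≡ count (Single-accepts-v1? n t) (orders n)
lemma12 n t _ 2<t t≤n∸2 =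
  Bijection.theorem n t (∸-monoˡ-≤ 1 2<t) (≤-trans (m∸n≤m t 1) (≤-trans t≤n∸2 (m∸n≤m n 2)))
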